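{- Let $G=(V,E)$ be a simple graph with $n=|V|$ vertices and let $UB\ge 2$ be an integer. Let $\Pi=(k,C_1,\ldots,C_n,U,F)$ be a partial $k$-coloring of $G$, let $M=\max\{|C_r| : 1\le r\le k\}$, and suppose $\Pi$ satisfies $\displaystyle |U| \ \ge\ \sum_{r=1}^{k}\Bigl(\max\Bigl\{M-1,\ \Bigl\lfloor \tfrac{n}{UB-1}\Bigr\rfloor\Bigr\} - |C_r|\Bigr)^+$. If $U=\varnothing$, then $C_1,\ldots,C_k$ is an equitable $k$-coloring of $G$.
   Context: For a real number $x$, $x^+=\max\{x,0\}$. A $k$-coloring of $G=(V,E)$ is a partition of $V$ into $k$ non-empty stable sets $C_1,\ldots,C_k$. An equitable $k$-coloring is a $k$-coloring with $\bigl||C_i|-|C_j|\bigr|\le 1$ for all $i,j\in\{1,\ldots,k\}$. A partial $k$-coloring of $G$ is a tuple $\Pi=(k,C_1,\ldots,C_n,U,F)$ where $k$ is a positive integer, $C_1,\ldots,C_n$ are pairwise disjoint stable sets of $G$ with $C_j\neq\varnothing$ if and only if $j\le k$, $U=V\setminus\bigcup_{j=1}^k C_j$ is the set of uncolored vertices, and $F$ assigns to each $u\in U$ its feasible color set $F(u)=\{j\in\{1,\ldots,n\}: \text{no vertex of } C_j \text{ is adjacent to } u\}$. -}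

module Defs where

open import Data.Nat using (ℕ; zero; suc; _+_; _∸_; _⊔_; _≤_; _<_; _/_)
open import Data.Fin using (Fin; toℕ; inject≤)
open import Data.Fin.Subset using (Subset; _∈_; _∉_; ∣_∣; ⋃; ∁; Nonempty; Empty; _∩_)
open import Data.List using (List; map; foldr; allFin)
open import Data.Nat.ListAction using (sum)
open import Data.Product using (_×_; Σ; ∃)
open import Relation.Binary.PropositionalEquality using (_≡_; _≢_)
open import Relation.Nullary using (¬_)
open import Function.Bundles using (_⇔_)

record SimpleGraph (n : ℕ) : Set₁ where
  field
    Adj   : Fin n → Fin n → Set
    sym   : ∀ {u v} → Adj u v → Adj v u
    irrefl : ∀ {u} → ¬ Adj u u

open SimpleGraph public

Stable : ∀ {n} → SimpleGraph n → Subset n → Set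
Stable G S = ∀ {u v} → u ∈ S → v ∈ S → ¬ Adj G u v

Disjoint : ∀ {n} → Subset n → Subset n → Set
Disjoint A B = ∀ {u} → u ∈ A → u ∉ B

record IsColoring {n : ℕ} (G : SimpleGraph n) (k : ℕ) (C : Fin k → Subset n) : Set where
  field
    nonempty : ∀ i → Nonempty (C i)
    stable   : ∀ i → Stable G (C i)
    disjoint : ∀ i j → i ≢ j → Disjoint (C i) (C j)
    cover    : ∀ (v : Fin n) → ∃ λ i → v ∈ C i

record IsEquitableColoring {n : ℕ} (G : SimpleGraph n) (k : ℕ) (C : Fin k → Subset n) : Set where
  field
    coloring  : IsColoring G k C
    equitable : ∀ i j → ∣ C i ∣ ≤ ∣ C j ∣ + 1

-- Partial k-coloring: colors are indexed by Fin n (color j+1 of the paper is j here).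
-- C j is nonempty iff toℕ j < k (i.e. paper's j ≤ k).
record IsPartialColoring {n : ℕ} (G : SimpleGraph n) (k : ℕ) (C : Fin n → Subset n) : Set where
  field
    k-pos    : 1 ≤ k
    stable   : ∀ j → Stable G (C j)
    disjoint : ∀ i j → i ≢ j → Disjoint (C i) (C j)
    nonempty⇔ : ∀ j → Nonempty (C j) ⇔ (toℕ j < k)

Uncolored : ∀ {n} → (Fin n → Subset n) → Subset n
Uncolored {n} C = ∁ (⋃ (map C (allFin n)))

-- Feasible color set F(u) (determined by the C_j; not needed in the statement).
Feasible : ∀ {n} → SimpleGraph n → (Fin n → Subset n) → Fin n → Fin n → Set
Feasible G C u j = ∀ {v} → v ∈ C j → ¬ Adj G v u

classes : ∀ {n k} → k ≤ n → (Fin n → Subset n) → Fin k → Subset n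
classes k≤n C r = C (inject≤ r k≤n)

maxFin : ∀ {k} → (Fin k → ℕ) → ℕ
maxFin {k} f = foldr _⊔_ 0 (map f (allFin k))

sumFin : ∀ {k} → (Fin k → ℕ) → ℕ
sumFin {k} f = sum (map f (allFin k))

-- ⌊ n / (UB - 1) ⌋ ; only meaningful for UB ≥ 2 (value 0 otherwise, never used).
floorDiv : ℕ → ℕ → ℕ
floorDiv n zero = 0
floorDiv n (suc zero) = 0
floorDiv n (suc (suc b)) = n / suc b

-- The right-hand side Σ_{r=1}^k ( max{M-1, ⌊n/(UB-1)⌋} - |C_r| )^+, with M = max_r |C_r|.
-- Natural truncated subtraction ∸ is exactly (x)^+ for x = a - b with a,b ∈ ℕ.
deficit : ∀ {n k} → k ≤ n → ℕ → (Fin n → Subset n) → ℕ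
deficit {n} {k} k≤n UB C =
  let Ck = classes k≤n C
      M  = maxFin (λ r → ∣ Ck r ∣)
  in sumFin (λ r → ((M ∸ 1) ⊔ floorDiv n UB) ∸ ∣ Ck r ∣)

module Submission where

-- With U = ∅ the hypothesis |U| ≥ Σ_r (t − |C_r|)^+ , where
-- t = max{M − 1, ⌊n/(UB−1)⌋}, says that this sum of natural numbers is 0.
-- Hence every summand vanishes, i.e. |C_r| ≥ t ≥ M − 1 for each r ≤ k.
-- As also |C_r| ≤ M, any two class sizes differ by at most one.
-- Separately, a partial k-colouring whose classes cover V restricts to a
-- genuine k-colouring on its first k classes: stability and disjointness are
-- inherited, non-emptiness is part of the definition, and a vertex lying in
-- C_j forces C_j ≠ ∅, hence j < k.

open import Defs
open import Data.Nat using (ℕ; _≤_)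
open import Data.Fin.Subset using (Subset; ∣_∣; Empty)
open import Data.Fin using (Fin)

open import Data.Nat using (_+_; _∸_; _⊔_; _<_)
open import Data.Nat.Properties
  using (≤-trans; ≤-reflexive; m≤m+n; m≤n+m; m≤m⊔n; m≤n⇒m≤o⊔n; m≤n+m∸n;
         +-comm; +-monoˡ-≤; m∸n≡0⇒m≤n; n≤0⇒n≡0; module ≤-Reasoning)
open import Data.Nat.ListAction using (sum)
open import Data.Fin using (toℕ; inject≤; fromℕ<)
open import Data.Fin.Properties using (toℕ<n; toℕ-inject≤; toℕ-fromℕ<; toℕ-injective; inject≤-injective)
open import Data.Fin.Subset using (_∈_; ⋃; ∁)
open import Data.Fin.Subset.Properties using (Empty-unique; ∣⊥∣≡0; ∉⊥; x∉∁p⇒x∈p; x∈p∪q⁻)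
open import Data.List using (List; []; _∷_; map; foldr; allFin)
open import Data.List.Membership.Propositional using () renaming (_∈_ to _∈ₗ_)
open import Data.List.Relation.Unary.Any using (here; there)
open import Data.List.Membership.Propositional.Properties using (∈-allFin; ∈-map⁺)
open import Data.Product using (_,_; ∃)
open import Data.Sum using (inj₁; inj₂)
open import Relation.Binary.PropositionalEquality using (_≡_; refl; trans; cong; subst) renaming (sym to ≡-sym)
open import Function.Bundles using (Equivalence)
open import Data.Empty using (⊥-elim)

∈⇒≤sum : ∀ {x} (xs : List ℕ) → x ∈ₗ xs → x ≤ sum xs
∈⇒≤sum (y ∷ ys) (here refl) = m≤m+n y (sum ys)
∈⇒≤sum (y ∷ ys) (there x∈ys) = ≤-trans (∈⇒≤sum ys x∈ys) (m≤n+m (sum ys) y)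

∈⇒≤max : ∀ {x} (xs : List ℕ) → x ∈ₗ xs → x ≤ foldr _⊔_ 0 xs
∈⇒≤max (y ∷ ys) (here refl) = m≤m⊔n y _
∈⇒≤max (y ∷ ys) (there x∈ys) = m≤n⇒m≤o⊔n y (∈⇒≤max ys x∈ys)

≤sumFin : ∀ {k} (f : Fin k → ℕ) i → f i ≤ sumFin f
≤sumFin f i = ∈⇒≤sum (map f (allFin _)) (∈-map⁺ f (∈-allFin i))

≤maxFin : ∀ {k} (f : Fin k → ℕ) i → f i ≤ maxFin f
≤maxFin f i = ∈⇒≤max (map f (allFin _)) (∈-map⁺ f (∈-allFin i))

sumFin-∸≤0⇒≥ : ∀ {k} t (g : Fin k → ℕ) → sumFin (λ r → t ∸ g r) ≤ 0 → ∀ r → t ≤ g r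
sumFin-∸≤0⇒≥ t g sum≤0 r =
  m∸n≡0⇒m≤n (n≤0⇒n≡0 (≤-trans (≤sumFin (λ r → t ∸ g r) r) sum≤0))

Empty⇒∣∣≡0 : ∀ {n} {S : Subset n} → Empty S → ∣ S ∣ ≡ 0
Empty⇒∣∣≡0 {n} S-empty = trans (cong ∣_∣ (Empty-unique S-empty)) (∣⊥∣≡0 n)

∈⋃map⁻ : ∀ {n m} (C : Fin m → Subset n) (xs : List (Fin m)) {v} →
         v ∈ ⋃ (map C xs) → ∃ λ j → v ∈ C j
∈⋃map⁻ C [] v∈ = ⊥-elim (∉⊥ v∈)
∈⋃map⁻ C (x ∷ xs) v∈ with x∈p∪q⁻ (C x) (⋃ (map C xs)) v∈
... | inj₁ v∈Cx = x , v∈Cx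
... | inj₂ v∈rest = ∈⋃map⁻ C xs v∈rest

noUncolored⇒covered : ∀ {n} (C : Fin n → Subset n) → Empty (Uncolored C) →
                      ∀ v → ∃ λ j → v ∈ C j
noUncolored⇒covered {n} C U-empty v =
  ∈⋃map⁻ C (allFin n) (x∉∁p⇒x∈p (λ v∈U → U-empty (v , v∈U)))

nearlyEqual : ∀ {M a b} → a ≤ M → M ∸ 1 ≤ b → a ≤ b + 1
nearlyEqual {M} {a} {b} a≤M M∸1≤b = begin
  a           ≤⟨ a≤M ⟩
  M           ≤⟨ m≤n+m∸n M 1 ⟩
  1 + (M ∸ 1) ≡⟨ +-comm 1 (M ∸ 1) ⟩
  (M ∸ 1) + 1 ≤⟨ +-monoˡ-≤ 1 M∸1≤b ⟩
  b + 1       ∎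
  where open ≤-Reasoning

zeroDeficit⇒equitable : ∀ {n k} (k≤n : k ≤ n) UB (C : Fin n → Subset n) →
                        deficit k≤n UB C ≤ 0 →
                        ∀ i j → ∣ classes k≤n C i ∣ ≤ ∣ classes k≤n C j ∣ + 1
zeroDeficit⇒equitable {n} k≤n UB C deficit≤0 i j =
  nearlyEqual (≤maxFin size i) (≤-trans (m≤m⊔n (M ∸ 1) _) (atLeastTarget j))
  where
  size : Fin _ → ℕ
  size r = ∣ classes k≤n C r ∣
  M : ℕ
  M = maxFin size
  atLeastTarget : ∀ r → (M ∸ 1) ⊔ floorDiv n UB ≤ size r
  atLeastTarget = sumFin-∸≤0⇒≥ ((M ∸ 1) ⊔ floorDiv n UB) size deficit≤0

coveringPartial⇒coloring : ∀ {n k} (G : SimpleGraph n) (C : Fin n → Subset n) (k≤n : k ≤ n) →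
                           IsPartialColoring G k C → (∀ v → ∃ λ j → v ∈ C j) →
                           IsColoring G k (classes k≤n C)
coveringPartial⇒coloring {k = k} G C k≤n pc covered = record
  { nonempty = λ i → Equivalence.from (nonempty⇔ (inject≤ i k≤n)) (injected<k i)
  ; stable   = λ i → stable (inject≤ i k≤n)
  ; disjoint = λ i j i≢j → disjoint _ _ (λ eq → i≢j (inject≤-injective k≤n k≤n i j eq))
  ; cover    = cover
  }
  where
  open IsPartialColoring pc

  injected<k : ∀ i → toℕ (inject≤ i k≤n) < k
  injected<k i = subst (_< k) (≡-sym (toℕ-inject≤ i k≤n)) (toℕ<n i)

  -- A vertex of C j witnesses C j ≠ ∅, hence j < k and C j is one of the first k classes.
  cover : ∀ v → ∃ λ i → v ∈ classes k≤n C i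
  cover v with covered v
  ... | j , v∈Cj = fromℕ< j<k , subst (λ c → v ∈ C c) (≡-sym inject-fromℕ<) v∈Cj
    where
    j<k : toℕ j < k
    j<k = Equivalence.to (nonempty⇔ j) (v , v∈Cj)
    inject-fromℕ< : inject≤ (fromℕ< j<k) k≤n ≡ j
    inject-fromℕ< = toℕ-injective (trans (toℕ-inject≤ _ k≤n) (toℕ-fromℕ< j<k))

mainTheorem2 : ∀ {n : ℕ} (G : SimpleGraph n) (UB k : ℕ) (C : Fin n → Subset n)
    (k≤n : k ≤ n) → 2 ≤ UB →
    IsPartialColoring G k C →
    deficit k≤n UB C ≤ ∣ Uncolored C ∣ →
    Empty (Uncolored C) →
    IsEquitableColoring G k (classes k≤n C)
mainTheorem2 G UB k C k≤n _ pc deficit≤∣U∣ U-empty = record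
  { coloring  = coveringPartial⇒coloring G C k≤n pc (noUncolored⇒covered C U-empty)
  ; equitable = zeroDeficit⇒equitable k≤n UB C deficit≤0
  }
  where
  deficit≤0 : deficit k≤n UB C ≤ 0
  deficit≤0 = ≤-trans deficit≤∣U∣ (≤-reflexive (Empty⇒∣∣≡0 U-empty))
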